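{- Let $t, s$ be terms such that $t$ satisfies condition $(\mathrm{LEN}_1)$. Then the following are equivalent: (1) $\mathsf{LANG} \models t \le s$; (2) $\hat{\mathfrak{v}}(t) \subseteq \hat{\mathfrak{v}}(s)$ for all language valuations $\mathfrak{v}$ over the set $\{\ell\}$ such that $\mathfrak{v}(x) \subseteq \{\mathrm{I}, \ell\}$ for all variables $x$; (3) $\hat{\mathfrak{v}}^{w}(t) \subseteq \hat{\mathfrak{v}}^{w}(s)$ for all language valuations $\mathfrak{v}$ (over any set $X$) and all words $w$ over $X$.
   Context: Let $\mathbf{V}$ be a set of variables. Terms are generated by $t, s ::= x \mid \mathrm{I} \mid \bot \mid t \cdot s \mid t \cup s \mid t^{*} \mid x^{ - }$ ($x \in \mathbf{V}$). For a set $X$, a language valuation over $X$ is a map $\mathfrak{v}$ from variables to subsets of $X^{*}$ ($\mathrm{I}$ = empty word), extended to terms $\hat{\mathfrak{v}}$ by $\hat{\mathfrak{v}}(\mathrm{I}) = \{\mathrm{I}\}$, $\hat{\mathfrak{v}}(\bot) = \emptyset$, $\hat{\mathfrak{v}}(t\cdot s) = \{ab \mid a \in \hat{\mathfrak{v}}(t), b \in \hat{\mathfrak{v}}(s)\}$, $\hat{\mathfrak{v}}(t \cup s) = \hat{\mathfrak{v}}(t)\cup\hat{\mathfrak{v}}(s)$, $\hat{\mathfrak{v}}(t^{*}) = \hat{\mathfrak{v}}(t)^{*}$, $\hat{\mathfrak{v}}(x^{ - }) = X^{*} \setminus \mathfrak{v}(x)$. $\mathsf{LANG} \models t \le s$ means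 $\hat{\mathfrak{v}}(t) \subseteq \hat{\mathfrak{v}}(s)$ for all language valuations over all sets. For a language valuation $\mathfrak{v}$ over $X$ and a word $w$ over $X$, $\mathfrak{v}^{w}$ is the language valuation over the one-letter set $\{\ell\}$ given by $\mathfrak{v}^{w}(x) = \{\mathrm{I} \mid \mathrm{I} \in \mathfrak{v}(x)\} \cup \{\ell \mid w \in \mathfrak{v}(x)\}$. A term $t$ satisfies condition $(\mathrm{LEN}_1)$ if for every language valuation $\mathfrak{v}$ (over any set $X$) and every non-empty word $w$ over $X$, $w \in \hat{\mathfrak{v}}(t)$ implies $\ell \in \hat{\mathfrak{v}}^{w}(t)$. -}

module Defs where

open import Data.List using (List; []; _∷_; _++_; [_])
open import Data.Product using (Σ; _×_; _,_)
open import Data.Sum using (_⊎_)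
open import Data.Unit using (⊤; tt)
open import Relation.Nullary using (¬_)
open import Relation.Binary.PropositionalEquality using (_≡_)
open import Function.Bundles using (_⇔_)

data Term (V : Set) : Set where
  var  : V → Term V
  𝐈    : Term V
  𝟘    : Term V
  _·_  : Term V → Term V → Term V
  _∪_  : Term V → Term V → Term V
  _⋆   : Term V → Term V
  _⁻   : V → Term V

-- A language over X is a subset of X* (predicate on words; [] is the empty word I)
Lang : Set → Set₁
Lang X = List X → Set

Valuation : Set → Set → Set₁
Valuation V X = V → Lang X

Concat : {X : Set} → Lang X → Lang X → Lang X
Concat L M w = Σ _ λ u → Σ _ λ u' → L u × M u' × (w ≡ u ++ u')

data Star {X : Set} (L : Lang X) : Lang X where
  nil  : Star L []
  cons : ∀ {u u'} → L u → Star L u' → Star L (u ++ u')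

⟦_⟧ : {V X : Set} → Term V → Valuation V X → Lang X
⟦ var x ⟧ v w = v x w
⟦ 𝐈 ⟧ v w = w ≡ []
⟦ 𝟘 ⟧ v w = Data.Empty.⊥
  where import Data.Empty
⟦ t · s ⟧ v = Concat (⟦ t ⟧ v) (⟦ s ⟧ v)
⟦ t ∪ s ⟧ v w = ⟦ t ⟧ v w ⊎ ⟦ s ⟧ v w
⟦ t ⋆ ⟧ v = Star (⟦ t ⟧ v)
⟦ x ⁻ ⟧ v w = ¬ (v x w)

LANG⊨_≤_ : {V : Set} → Term V → Term V → Set₁
LANG⊨_≤_ {V} t s = (X : Set) (v : Valuation V X) (w : List X) → ⟦ t ⟧ v w → ⟦ s ⟧ v w

ℓ : ⊤
ℓ = tt

_^_ : {V X : Set} → Valuation V X → List X → Valuation V ⊤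
(v ^ w) x u = (u ≡ [] × v x []) ⊎ (u ≡ [ ℓ ] × v x w)

NonEmpty : {X : Set} → List X → Set
NonEmpty w = ¬ (w ≡ [])

LEN₁ : {V : Set} → Term V → Set₁
LEN₁ {V} t = (X : Set) (v : Valuation V X) (w : List X) → NonEmpty w →
             ⟦ t ⟧ v w → ⟦ t ⟧ (v ^ w) [ ℓ ]

Cond2 : {V : Set} → Term V → Term V → Set₁
Cond2 {V} t s = (v : Valuation V ⊤) →
                ((x : V) (u : List ⊤) → v x u → (u ≡ []) ⊎ (u ≡ [ ℓ ])) →
                (u : List ⊤) → ⟦ t ⟧ v u → ⟦ s ⟧ v u

Cond3 : {V : Set} → Term V → Term V → Set₁
Cond3 {V} t s = (X : Set) (v : Valuation V X) (w : List X) →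
                (u : List ⊤) → ⟦ t ⟧ (v ^ w) u → ⟦ s ⟧ (v ^ w) u

{-# OPTIONS --safe #-}
module Submission where

open import Defs
open import Data.Product using (_×_; _,_)
open import Data.Sum using (_⊎_; inj₁; inj₂)
open import Data.List using (List; []; _∷_; _++_; [_])
open import Data.List.Properties using (++-identityʳ)
open import Data.Unit using (⊤)
open import Relation.Binary.PropositionalEquality using (_≡_; refl; sym; subst)
open import Function.Bundles using (_⇔_; mk⇔)

-- The valuation v ^ w remembers of v only the membership of I and of w.  By
-- induction on terms the same holds for every term: I ∈ v̂^w(t) iff I ∈ v̂(t),
-- and ℓ ∈ v̂^w(t) implies w ∈ v̂(t), since the only factorisations of ℓ are
-- I·ℓ and ℓ·I.  So condition (3) already yields t ≤ s at the empty word, and at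
-- a nonempty word w it does too once (LEN₁) moves w ∈ v̂(t) to ℓ ∈ v̂^w(t).

^-preserves-[] : {V X : Set} (t : Term V) (v : Valuation V X) (w : List X) →
                 ⟦ t ⟧ v [] → ⟦ t ⟧ (v ^ w) []
^-preserves-[] (var x) v w p = inj₁ (refl , p)
^-preserves-[] 𝐈 v w p = refl
^-preserves-[] 𝟘 v w ()
^-preserves-[] (t · s) v w ([] , [] , p , q , refl) =
  [] , [] , ^-preserves-[] t v w p , ^-preserves-[] s v w q , refl
^-preserves-[] (t ∪ s) v w (inj₁ p) = inj₁ (^-preserves-[] t v w p)
^-preserves-[] (t ∪ s) v w (inj₂ q) = inj₂ (^-preserves-[] s v w q)
^-preserves-[] (t ⋆) v w p = nil
^-preserves-[] (x ⁻) v w p (inj₁ (_ , q)) = p q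
^-preserves-[] (x ⁻) v w p (inj₂ (() , _))

^-reflects-[] : {V X : Set} (t : Term V) (v : Valuation V X) (w : List X) →
                ⟦ t ⟧ (v ^ w) [] → ⟦ t ⟧ v []
^-reflects-[] (var x) v w (inj₁ (_ , p)) = p
^-reflects-[] (var x) v w (inj₂ (() , _))
^-reflects-[] 𝐈 v w p = refl
^-reflects-[] 𝟘 v w ()
^-reflects-[] (t · s) v w ([] , [] , p , q , refl) =
  [] , [] , ^-reflects-[] t v w p , ^-reflects-[] s v w q , refl
^-reflects-[] (t ∪ s) v w (inj₁ p) = inj₁ (^-reflects-[] t v w p)
^-reflects-[] (t ∪ s) v w (inj₂ q) = inj₂ (^-reflects-[] s v w q)
^-reflects-[] (t ⋆) v w p = nil
^-reflects-[] (x ⁻) v w p q = p (inj₁ (refl , q))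

Star-[ℓ] : {X : Set} {L : Lang ⊤} {M : Lang X} {w : List X} →
           (L [ ℓ ] → M w) → ∀ {u} → Star L u → u ≡ [ ℓ ] → Star M w
Star-[ℓ] f nil ()
Star-[ℓ] f (cons {[]} p ps) eq = Star-[ℓ] f ps eq
Star-[ℓ] {M = M} {w = w} f (cons {_ ∷ []} {[]} p ps) refl =
  subst (Star M) (++-identityʳ w) (cons (f p) nil)
Star-[ℓ] f (cons {_ ∷ []} {_ ∷ _} p ps) ()
Star-[ℓ] f (cons {_ ∷ _ ∷ _} p ps) ()

^-reflects-[ℓ] : {V X : Set} (t : Term V) (v : Valuation V X) (w : List X) →
                 ⟦ t ⟧ (v ^ w) [ ℓ ] → ⟦ t ⟧ v w
^-reflects-[ℓ] (var x) v w (inj₁ (() , _))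
^-reflects-[ℓ] (var x) v w (inj₂ (_ , p)) = p
^-reflects-[ℓ] 𝐈 v w ()
^-reflects-[ℓ] 𝟘 v w ()
^-reflects-[ℓ] (t · s) v w ([] , _ , p , q , refl) =
  [] , w , ^-reflects-[] t v w p , ^-reflects-[ℓ] s v w q , refl
^-reflects-[ℓ] (t · s) v w (_ ∷ [] , [] , p , q , refl) =
  w , [] , ^-reflects-[ℓ] t v w p , ^-reflects-[] s v w q , sym (++-identityʳ w)
^-reflects-[ℓ] (t · s) v w (_ ∷ [] , _ ∷ _ , p , q , ())
^-reflects-[ℓ] (t · s) v w (_ ∷ _ ∷ _ , _ , p , q , ())
^-reflects-[ℓ] (t ∪ s) v w (inj₁ p) = inj₁ (^-reflects-[ℓ] t v w p)
^-reflects-[ℓ] (t ∪ s) v w (inj₂ q) = inj₂ (^-reflects-[ℓ] s v w q)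
^-reflects-[ℓ] (t ⋆) v w p = Star-[ℓ] (^-reflects-[ℓ] t v w) p refl
^-reflects-[ℓ] (x ⁻) v w p q = p (inj₂ (refl , q))

^-⊆-I,ℓ : {V X : Set} (v : Valuation V X) (w : List X) (x : V) (u : List ⊤) →
          (v ^ w) x u → (u ≡ []) ⊎ (u ≡ [ ℓ ])
^-⊆-I,ℓ v w x u (inj₁ (u≡[] , _)) = inj₁ u≡[]
^-⊆-I,ℓ v w x u (inj₂ (u≡[ℓ] , _)) = inj₂ u≡[ℓ]

Cond2⇒Cond3 : {V : Set} (t s : Term V) → Cond2 t s → Cond3 t s
Cond2⇒Cond3 t s c2 X v w = c2 (v ^ w) (^-⊆-I,ℓ v w)

Cond3⇒LANG : {V : Set} (t s : Term V) → LEN₁ t → Cond3 t s → LANG⊨ t ≤ s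
Cond3⇒LANG t s len c3 X v [] p =
  ^-reflects-[] s v [] (c3 X v [] [] (^-preserves-[] t v [] p))
Cond3⇒LANG t s len c3 X v w@(_ ∷ _) p =
  ^-reflects-[ℓ] s v w (c3 X v w [ ℓ ] (len X v w (λ ()) p))

LANG⇒Cond2 : {V : Set} (t s : Term V) → LANG⊨ t ≤ s → Cond2 t s
LANG⇒Cond2 t s t≤s v _ = t≤s ⊤ v

LANG⇒Cond3 : {V : Set} (t s : Term V) → LANG⊨ t ≤ s → Cond3 t s
LANG⇒Cond3 t s t≤s X v w = t≤s ⊤ (v ^ w)

theorem4p7 : {V : Set} (t s : Term V) → LEN₁ t →
    ((LANG⊨ t ≤ s) ⇔ Cond2 t s) × ((LANG⊨ t ≤ s) ⇔ Cond3 t s)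
theorem4p7 t s len =
  mk⇔ (LANG⇒Cond2 t s) (λ c2 → Cond3⇒LANG t s len (Cond2⇒Cond3 t s c2)) ,
  mk⇔ (LANG⇒Cond3 t s) (Cond3⇒LANG t s len)
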